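{- Let $D$ be a well-oriented symmetrized six-vertex configuration and let $w=s_{i_1}\cdots s_{i_l}$ be a reduced sequence of ASM moves on $D$, with corresponding square faces $F_{i_1},\dots,F_{i_l}$. Suppose there is $F_0\in S(D)$ with $s_{i_1}=s_{i_l}=s_0$, and let $F_1,\dots,F_4$ be the faces adjacent to $F_0$ in $D$. Then each of the moves $s_1,\dots,s_4$ appears at least once in $w$.
   Context: A symmetrized six-vertex configuration is a planar directed graph in a disk with degree-$1$ boundary vertices, every internal vertex of degree $4$ being a source, sink, or transmitting vertex (two cyclically consecutive incoming and two cyclically consecutive outgoing edges). A $\mathsf{trip}_2$-strand goes straight across at each internal vertex. Yang–Baxter move: at a cyclically oriented triangular face formed by three strands, slide one strand across the crossing of the other two; ASM move: reverse the four edges of a square face when the result is valid. Well-oriented: simple, no isolated components, every $3$-cycle of every move-equivalent configuration cyclically oriented. $S(D)$ is the set of square faces of $D$ admitting ASM moves, and $s_F$ denotes the ASM move at face $F$ (faces are identified across ASM moves, which do not change the underlying graph). A sequence of moves on $D$ is a word $w_1\cdots w_l$ where $w_l$ is applicable to $D$ and $w_1\cdots w_{l-1}$ is a sequence of moves on $w_l(D)$; sequences are equivalent if they produce the same configuration; a sequence of length $l$ is reduced if it is not equivalent to any sequence of length $<l$. -}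

module Defs where

-- Symmetrized six-vertex configurations in a disk, encoded as combinatorial
-- maps (rotation systems).

open import Data.Bool using (Bool; true; false; not; _∧_; _∨_; if_then_else_)
open import Data.Nat using (ℕ; zero; suc; _+_; _*_; _<_; _<ᵇ_)
open import Data.Fin using (Fin; toℕ)
open import Data.Fin.Properties using (_≟_)
open import Data.List using (List; []; _∷_; length)
open import Data.List.Membership.Propositional using (_∈_; _∉_)
open import Data.Product using (Σ; _×_; _,_)
open import Data.Sum using (_⊎_)
open import Data.Unit using (⊤)
open import Function using (_∘_)
open import Relation.Nullary using (¬_)
open import Relation.Nullary.Decidable using (⌊_⌋)
open import Relation.Binary.PropositionalEquality using (_≡_; _≢_)
open import Relation.Binary.Construct.Closure.ReflexiveTransitive using (Star)
open import Relation.Binary.Construct.Closure.Symmetric using (SymClosure)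

eqB : ∀ {n} → Fin n → Fin n → Bool
eqB d e = ⌊ d ≟ e ⌋

iter : ∀ {A : Set} → (A → A) → ℕ → A → A
iter f zero x = x
iter f (suc k) x = f (iter f k x)

reachB : ∀ {n} → (Fin n → Fin n) → ℕ → Fin n → Fin n → Bool
reachB f zero d e = eqB d e
reachB f (suc k) d e = eqB d e ∨ reachB f k (f d) e

-- e lies in the f-orbit of d (for permutations of Fin n, n steps suffice)
Reach : ∀ {n} → (Fin n → Fin n) → Fin n → Fin n → Set
Reach {n} f d e = reachB f n d e ≡ true

anyFin : ∀ {n} → (Fin n → Bool) → Bool
anyFin {zero} p = false
anyFin {suc n} p = p Fin.zero ∨ anyFin (p ∘ Fin.suc)

countB : ∀ {n} → (Fin n → Bool) → ℕ
countB {zero} p = 0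
countB {suc n} p = (if p Fin.zero then 1 else 0) + countB (p ∘ Fin.suc)

isRep : ∀ {n} → (Fin n → Fin n) → Fin n → Bool
isRep {n} f d = not (anyFin (λ e → (toℕ e <ᵇ toℕ d) ∧ reachB f n d e))

numOrbits : ∀ {n} → (Fin n → Fin n) → ℕ
numOrbits f = countB (isRep f)

-- Darts are Fin n.
--   σ  : rotation (cyclic order of darts around a vertex), σ⁻ its inverse
--   α  : edge involution (the other half of the edge)
--   arc d = true : d is a half-edge of the boundary circle of the disk
--                  (these are NOT edges of the configuration)
-- Vertices are σ-orbits, faces are φ-orbits with φ = σ⁻ ∘ α.

record RawMap (n : ℕ) : Set where
  field
    σ σ⁻ α : Fin n → Fin n
    arc : Fin n → Bool

module _ {n : ℕ} (M : RawMap n) where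
  open RawMap M

  φ : Fin n → Fin n
  φ = σ⁻ ∘ α

  Graph : Fin n → Set
  Graph d = arc d ≡ false

  SameVertex : Fin n → Fin n → Set
  SameVertex = Reach σ

  SameFace : Fin n → Fin n → Set
  SameFace = Reach φ

  InternalAt : Fin n → Set
  InternalAt d = iter σ 4 d ≡ d × iter σ 2 d ≢ d
               × Graph d × Graph (σ d) × Graph (iter σ 2 d) × Graph (iter σ 3 d)

  -- d is the unique configuration dart at a boundary vertex (degree 1 in the
  -- configuration; in the map it also carries two boundary-circle darts)
  BoundaryAt : Fin n → Set
  BoundaryAt d = Graph d × arc (σ d) ≡ true × arc (iter σ 2 d) ≡ true
               × iter σ 3 d ≡ d × iter σ 2 d ≢ σ d

  MapStep : Fin n → Fin n → Set
  MapStep d e = e ≡ σ d ⊎ e ≡ α d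

  -- the map is a connected genus-0 map in which the boundary-circle darts
  -- form a single cycle bounding one face (the outside of the disk); hence
  -- the configuration is a planar graph in a disk whose degree-1 vertices
  -- lie on the boundary circle and whose other vertices have degree 4.
  record IsDisk : Set where
    field
      σ-inv₁ : ∀ d → σ⁻ (σ d) ≡ d
      σ-inv₂ : ∀ d → σ (σ⁻ d) ≡ d
      α-invol : ∀ d → α (α d) ≡ d
      α-fpf : ∀ d → α d ≢ d
      arc-α : ∀ d → arc (α d) ≡ arc d
      vertices : ∀ d → Graph d → InternalAt d ⊎ BoundaryAt d
      arcVertices : ∀ a → arc a ≡ true →
        Σ (Fin n) λ g → BoundaryAt g × (σ g ≡ a ⊎ iter σ 2 g ≡ a)
      outer : Σ (Fin n) λ o → arc o ≡ true
        × (∀ e → SameFace o e → arc e ≡ true)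
        × (∀ a → arc a ≡ true →
             (SameFace o a × ¬ SameFace o (α a))
             ⊎ (¬ SameFace o a × SameFace o (α a)))
      connected : ∀ d e → Star MapStep d e
      euler : 2 * (numOrbits σ + numOrbits φ) ≡ n + 4

  -- Orientations.  ori d = true  means: the edge of d points away from the
  -- vertex of d (d is the tail half-edge).

  -- admissible orientation pattern at a degree-4 vertex, darts in cyclic
  -- order: source, sink, or transmitting (two cyclically consecutive
  -- incoming and two cyclically consecutive outgoing edges)
  valid4 : Bool → Bool → Bool → Bool → Bool
  valid4 true  true  true  true  = true
  valid4 false false false false = true
  valid4 true  true  false false = true
  valid4 false true  true  false = true
  valid4 false false true  true  = true
  valid4 true  false false true  = true
  valid4 _     _     _     _     = false

  ValidOri : (Fin n → Bool) → Set
  ValidOri o = (∀ d → Graph d → o (α d) ≡ not (o d))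
             × (∀ d → InternalAt d →
                  valid4 (o d) (o (σ d)) (o (iter σ 2 d)) (o (iter σ 3 d)) ≡ true)

  -- trip₂ : go straight across at internal vertices, turn back at the
  -- boundary.  Two edges lie on the same strand iff related by SameStrand.
  τ : Fin n → Fin n
  τ d = if arc (σ (α d)) then α d else iter σ 2 (α d)

  SameStrand : Fin n → Fin n → Set
  SameStrand d e = Reach τ d e ⊎ Reach τ d (α e)

  IsSquare : Fin n → Set
  IsSquare f = iter φ 4 f ≡ f × iter φ 2 f ≢ f
             × Graph f × Graph (φ f) × Graph (iter φ 2 f) × Graph (iter φ 3 f)

  flipAt : Fin n → (Fin n → Bool) → (Fin n → Bool)
  flipAt f o d = if reachB φ n f d ∨ reachB φ n f (α d) then not (o d) else o d

  -- the ASM move at the face of f applies to orientation o (f ∈ S(·))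
  Applicable : Fin n → (Fin n → Bool) → Set
  Applicable f o = IsSquare f × ValidOri (flipAt f o)

  -- a word  w₁ ⋯ wₗ  (as the list w₁ ∷ … ∷ wₗ ∷ []) of ASM moves; wₗ acts first
  applySeq : List (Fin n) → (Fin n → Bool) → (Fin n → Bool)
  applySeq [] o = o
  applySeq (f ∷ w) o = flipAt f (applySeq w o)

  IsSeq : List (Fin n) → (Fin n → Bool) → Set
  IsSeq [] o = ⊤
  IsSeq (f ∷ w) o = IsSeq w o × Applicable f (applySeq w o)

  Reduced : List (Fin n) → (Fin n → Bool) → Set
  Reduced w o = ∀ v → IsSeq v o → length v < length w →
                ¬ (∀ d → applySeq v o d ≡ applySeq w o d)

  Simple : Set
  Simple = (∀ d → Graph d → ¬ SameVertex d (α d))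
         × (∀ d e → Graph d → Graph e → SameVertex d e → d ≢ e →
              ¬ SameVertex (α d) (α e))

  GraphStep : Fin n → Fin n → Set
  GraphStep d e = Graph d × Graph e × (e ≡ σ d ⊎ e ≡ α d)

  NoIsolatedComponents : Set
  NoIsolatedComponents = ∀ d → Graph d →
    Σ (Fin n) λ b → BoundaryAt b × Star GraphStep d b

  ThreeCycle : Fin n → Fin n → Fin n → Set
  ThreeCycle d₀ d₁ d₂ = Graph d₀ × Graph d₁ × Graph d₂
    × SameVertex (α d₀) d₁ × SameVertex (α d₁) d₂ × SameVertex (α d₂) d₀
    × ¬ SameVertex d₀ d₁ × ¬ SameVertex d₁ d₂ × ¬ SameVertex d₀ d₂

  CyclicallyOriented : (Fin n → Bool) → Fin n → Fin n → Fin n → Set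
  CyclicallyOriented o d₀ d₁ d₂ = o d₀ ≡ o d₁ × o d₁ ≡ o d₂

record Config (n : ℕ) : Set where
  field
    raw : RawMap n
    disk : IsDisk raw
    ori : Fin n → Bool

open Config public
open RawMap public

SameRaw : ∀ {n} → RawMap n → RawMap n → Set
SameRaw {n} M N = (∀ d → α N d ≡ α M d) × (∀ d → arc N d ≡ arc M d)

ASMStep : ∀ {n} → Config n → Config n → Set
ASMStep {n} C C' = SameRaw (raw C) (raw C') × (∀ d → σ (raw C') d ≡ σ (raw C) d)
  × ValidOri (raw C) (ori C)
  × Σ (Fin n) λ f → Applicable (raw C) f (ori C)
      × (∀ d → ori C' d ≡ flipAt (raw C) f (ori C) d)

-- Yang–Baxter move at a cyclically oriented triangular face t₀ t₁ t₂
-- (tᵢ₊₁ = φ tᵢ) whose three edges lie on three distinct strands.  With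
-- uᵢ = σ tᵢ, pᵢ = σ² tᵢ, qᵢ = σ³ tᵢ the strand opposite the corner of t₀
-- is slid across: the new rotation is the product of the 4-cycles
-- (q₁ p₂ t₀ u₀)(q₂ p₀ t₁ u₁)(q₀ p₁ t₂ u₂), α and the boundary are kept,
-- external edges keep their orientation and the triangle edges are reversed.
YBStep : ∀ {n} → Config n → Config n → Set
YBStep {n} C C' = SameRaw M (raw C') × ValidOri M (ori C) × ValidOri (raw C') (ori C')
  × Σ (Fin n) λ t₀ →
    let t₁ = φ M t₀ ; t₂ = φ M t₁
        s = σ M ; s' = σ (raw C')
        u₀ = s t₀ ; u₁ = s t₁ ; u₂ = s t₂
        p₀ = s (s t₀) ; p₁ = s (s t₁) ; p₂ = s (s t₂)
        q₀ = s p₀ ; q₁ = s p₁ ; q₂ = s p₂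
        moved = t₀ ∷ t₁ ∷ t₂ ∷ u₀ ∷ u₁ ∷ u₂ ∷ p₀ ∷ p₁ ∷ p₂ ∷ q₀ ∷ q₁ ∷ q₂ ∷ []
        tri = t₀ ∷ t₁ ∷ t₂ ∷ α M t₀ ∷ α M t₁ ∷ α M t₂ ∷ []
    in (φ M t₂ ≡ t₀ × t₁ ≢ t₀ × Graph M t₀ × Graph M t₁ × Graph M t₂)
     × (ori C t₀ ≡ ori C t₁ × ori C t₁ ≡ ori C t₂)
     × (¬ SameStrand M t₀ t₁ × ¬ SameStrand M t₁ t₂ × ¬ SameStrand M t₀ t₂)
     × (s' q₁ ≡ p₂ × s' p₂ ≡ t₀ × s' t₀ ≡ u₀ × s' u₀ ≡ q₁)
     × (s' q₂ ≡ p₀ × s' p₀ ≡ t₁ × s' t₁ ≡ u₁ × s' u₁ ≡ q₂)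
     × (s' q₀ ≡ p₁ × s' p₁ ≡ t₂ × s' t₂ ≡ u₂ × s' u₂ ≡ q₀)
     × (∀ d → d ∉ moved → s' d ≡ s d)
     × (∀ d → d ∈ tri → ori C' d ≡ not (ori C d))
     × (∀ d → d ∉ tri → ori C' d ≡ ori C d)
  where M = raw C

Move : ∀ {n} → Config n → Config n → Set
Move C C' = ASMStep C C' ⊎ YBStep C C'

MoveEquivalent : ∀ {n} → Config n → Config n → Set
MoveEquivalent = Star (SymClosure Move)

WellOriented : ∀ {n} → Config n → Set
WellOriented {n} D = Simple (raw D) × NoIsolatedComponents (raw D)
  × (∀ D' → MoveEquivalent D D' → ∀ d₀ d₁ d₂ →
       ThreeCycle (raw D') d₀ d₁ d₂ → CyclicallyOriented (raw D') (ori D') d₀ d₁ d₂)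

module Submission where

open import Defs
open import Data.Bool using (Bool; true; false; not; _∨_; _xor_; if_then_else_)
open import Data.Bool.Properties using (∨-comm; ⇔→≡; not-¬; not-involutive) renaming (_≟_ to _≟ᵇ_)
open import Data.Empty using (⊥; ⊥-elim)
open import Data.Fin using (Fin; zero; suc)
open import Data.Fin.Properties using (_≟_)
open import Data.List using (List; []; _∷_; _++_; length)
open import Data.List.Properties using (length-++; length-++-≤ˡ; ++-assoc)
open import Data.List.Relation.Unary.All as All using (All; []; _∷_)
open import Data.List.Relation.Unary.All.Properties using (¬Any⇒All¬; All¬⇒¬Any; ++⁻ˡ; ++⁻ʳ)
open import Data.List.Relation.Unary.Any as Any using (Any; here; there; any?)
open import Data.List.Relation.Unary.Any.Properties using (++⁺ˡ; ++⁺ʳ)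
open import Data.Nat using (ℕ; zero; suc; _+_; _*_; _≤_; _<_; z≤n; s≤s)
open import Data.Nat.Properties using (≤-trans; ≤-refl; ≤-pred; n≤1+n; +-comm; *-comm; +-monoʳ-<; +-monoˡ-<)
open import Data.Product using (∃; _×_; _,_; proj₁; proj₂)
open import Data.Sum using (_⊎_; inj₁; inj₂; [_,_]′)
open import Data.Unit using (tt)
open import Function using (_∘_)
open import Function.Bundles using (mk⇔)
open import Relation.Nullary using (¬_; Dec; yes; no)
open import Relation.Nullary.Decidable using (_→-dec_; from-yes)
open import Relation.Unary using (Decidable)
open import Relation.Binary.PropositionalEquality

-- If the face F₀ recurs strictly inside the word, the
-- induction hypothesis applies to the shorter reduced subword between two of its occurrences.
-- Otherwise fix an edge x of F₀.  Two inner moves on the face across x would enclose, by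
-- induction, a move at F₀; a single one would reverse x exactly once.  But whenever the move
-- at F₀ is possible the edges of F₀ alternate around the face (at each corner the move reverses
-- exactly the two face darts, which for a valid vertex forces them to agree; this is where
-- simplicity enters), so the orientations after the first s₀ and before the last one agree on
-- all of F₀ as soon as they agree on e, which no inner move touches (else we are done).
-- Hence no inner move shares an edge with F₀.  Since validity of a move is a condition at single vertices, the last s₀ then
-- commutes past the middle of the word and cancels the first, contradicting reducedness.

private variable
  n : ℕ
  A : Set

iter-comm : ∀ (f : A → A) j x → iter f j (f x) ≡ f (iter f j x)
iter-comm f zero    x = refl
iter-comm f (suc j) x = cong f (iter-comm f j x)

iter-+ : ∀ (f : A → A) i j x → iter f (i + j) x ≡ iter f i (iter f j x)
iter-+ f zero    j x = refl
iter-+ f (suc i) j x = cong f (iter-+ f i j x)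

iter-swap : ∀ (f : A → A) i j x → iter f i (iter f j x) ≡ iter f j (iter f i x)
iter-swap f i j x = begin
  iter f i (iter f j x) ≡⟨ iter-+ f i j x ⟨
  iter f (i + j) x      ≡⟨ cong (λ k → iter f k x) (+-comm i j) ⟩
  iter f (j + i) x      ≡⟨ iter-+ f j i x ⟩
  iter f j (iter f i x) ∎
  where open ≡-Reasoning

iter-injective : ∀ (f : A → A) → (∀ {x y} → f x ≡ f y → x ≡ y) →
                 ∀ j {x y} → iter f j x ≡ iter f j y → x ≡ y
iter-injective f inj zero    eq = eq
iter-injective f inj (suc j) eq = iter-injective f inj j (inj eq)

eqB-refl : (d : Fin n) → eqB d d ≡ true
eqB-refl d with d ≟ d
... | yes _   = refl
... | no d≢d = ⊥-elim (d≢d refl)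

eqB-sound : (d e : Fin n) → eqB d e ≡ true → d ≡ e
eqB-sound d e eq with d ≟ e
... | yes d≡e = d≡e
eqB-sound d e () | no _

∨-≡-true⁻ : ∀ a b → a ∨ b ≡ true → a ≡ true ⊎ b ≡ true
∨-≡-true⁻ true  b _  = inj₁ refl
∨-≡-true⁻ false b eq = inj₂ eq

∨-≡-trueʳ : ∀ a {b} → b ≡ true → a ∨ b ≡ true
∨-≡-trueʳ true  _  = refl
∨-≡-trueʳ false eq = eq

reachB⇒iter : (f : Fin n → Fin n) → ∀ k d e → reachB f k d e ≡ true → ∃ λ j → iter f j d ≡ e
reachB⇒iter f zero    d e r = 0 , eqB-sound d e r
reachB⇒iter f (suc k) d e r with ∨-≡-true⁻ (eqB d e) (reachB f k (f d) e) r
... | inj₁ d≡e = 0 , eqB-sound d e d≡e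
... | inj₂ r′  with reachB⇒iter f k (f d) e r′
...   | j , eq = suc j , trans (sym (iter-comm f j d)) eq

iter⇒reachB : (f : Fin n → Fin n) → ∀ k j d → j ≤ k → reachB f k d (iter f j d) ≡ true
iter⇒reachB f zero    zero    d z≤n     = eqB-refl d
iter⇒reachB f (suc k) zero    d _       = cong (_∨ reachB f k (f d) d) (eqB-refl d)
iter⇒reachB f (suc k) (suc j) d (s≤s j≤k) =
  ∨-≡-trueʳ (eqB d _) (subst (λ t → reachB f k (f d) t ≡ true) (iter-comm f j d) (iter⇒reachB f k j (f d) j≤k))

distinct³⇒3≤n : {x y z : Fin n} → x ≢ y → y ≢ z → x ≢ z → 3 ≤ n
distinct³⇒3≤n {suc (suc (suc _))} _ _ _ = s≤s (s≤s (s≤s z≤n))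
distinct³⇒3≤n {1} {zero}     {zero}                 x≢y _   _   = ⊥-elim (x≢y refl)
distinct³⇒3≤n {2} {zero}     {zero}                 x≢y _   _   = ⊥-elim (x≢y refl)
distinct³⇒3≤n {2} {suc zero} {suc zero}             x≢y _   _   = ⊥-elim (x≢y refl)
distinct³⇒3≤n {2} {zero}     {suc zero} {zero}      _   _   x≢z = ⊥-elim (x≢z refl)
distinct³⇒3≤n {2} {zero}     {suc zero} {suc zero}  _   y≢z _   = ⊥-elim (y≢z refl)
distinct³⇒3≤n {2} {suc zero} {zero}     {zero}      _   y≢z _   = ⊥-elim (y≢z refl)
distinct³⇒3≤n {2} {suc zero} {zero}     {suc zero}  _   _   x≢z = ⊥-elim (x≢z refl)

Orbit : (A → A) → A → A → Set
Orbit f y z = ∃ λ j → iter f j y ≡ z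

Orbit-refl : ∀ (f : A → A) y → Orbit f y y
Orbit-refl f y = 0 , refl

Orbit-step : ∀ (f : A → A) y → Orbit f y (f y)
Orbit-step f y = 1 , refl

Orbit-trans : ∀ (f : A → A) {x y z} → Orbit f x y → Orbit f y z → Orbit f x z
Orbit-trans f {x} (i , refl) (j , refl) = j + i , iter-+ f j i x

module FourPeriodic {n} (f : Fin n → Fin n) (f-injective : ∀ {x y} → f x ≡ f y → x ≡ y) (3≤n : 3 ≤ n) where

  HasPeriod4 : Fin n → Set
  HasPeriod4 y = iter f 4 y ≡ y

  iter-mod4 : ∀ {y} → HasPeriod4 y → ∀ j → ∃ λ r → r ≤ 3 × iter f j y ≡ iter f r y
  iter-mod4 p 0 = 0 , z≤n , refl
  iter-mod4 p 1 = 1 , s≤s z≤n , refl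
  iter-mod4 p 2 = 2 , s≤s (s≤s z≤n) , refl
  iter-mod4 p 3 = 3 , ≤-refl , refl
  iter-mod4 {y} p (suc (suc (suc (suc j)))) with iter-mod4 p j
  ... | r , r≤3 , eq = r , r≤3 , trans (sym (iter-swap f j 4 y)) (trans (cong (iter f j) p) eq)

  Orbit⇒reachB : ∀ {y z} → HasPeriod4 y → Orbit f y z → reachB f n y z ≡ true
  Orbit⇒reachB {y} p (j , refl) with iter-mod4 p j
  ... | r , r≤3 , eq = subst (λ t → reachB f n y t ≡ true) (sym eq) (iter⇒reachB f n r y (≤-trans r≤3 3≤n))

  reachB⇒Orbit : ∀ {y z} → reachB f n y z ≡ true → Orbit f y z
  reachB⇒Orbit {y} {z} = reachB⇒iter f n y z

  HasPeriod4-Orbit : ∀ {y z} → HasPeriod4 y → Orbit f y z → HasPeriod4 z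
  HasPeriod4-Orbit {y} p (j , refl) = trans (iter-swap f 4 j y) (cong (iter f j) p)

  HasPeriod4-Orbit⁻ : ∀ {y z} → HasPeriod4 z → Orbit f y z → HasPeriod4 y
  HasPeriod4-Orbit⁻ {y} p (j , refl) =
    iter-injective f f-injective j (trans (iter-swap f j 4 y) p)

  Orbit-sym : ∀ {y z} → HasPeriod4 y → Orbit f y z → Orbit f z y
  Orbit-sym {y} p (j , refl) = j * 3 , (begin
    iter f (j * 3) (iter f j y) ≡⟨ iter-+ f (j * 3) j y ⟨
    iter f (j * 3 + j) y        ≡⟨ cong (λ k → iter f k y) (j*3+j≡j*4 j) ⟩
    iter f (j * 4) y            ≡⟨ iter-multiple j ⟩
    y                           ∎)
    where
    open ≡-Reasoning
    j*3+j≡j*4 : ∀ j → j * 3 + j ≡ j * 4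
    j*3+j≡j*4 j = trans (+-comm (j * 3) j) (trans (cong (j +_) (*-comm j 3)) (*-comm 4 j))
    iter-multiple : ∀ j → iter f (j * 4) y ≡ y
    iter-multiple zero    = refl
    iter-multiple (suc j) = trans (iter-+ f 4 (j * 4) y) (trans (cong (iter f 4) (iter-multiple j)) p)

  orbit-cases : ∀ {y z} → HasPeriod4 y → Orbit f y z →
                z ≡ y ⊎ z ≡ f y ⊎ z ≡ f (f y) ⊎ z ≡ f (f (f y))
  orbit-cases p (j , refl) with iter-mod4 p j
  ... | 0 , _ , eq = inj₁ eq
  ... | 1 , _ , eq = inj₂ (inj₁ eq)
  ... | 2 , _ , eq = inj₂ (inj₂ (inj₁ eq))
  ... | 3 , _ , eq = inj₂ (inj₂ (inj₂ eq))
  ... | suc (suc (suc (suc _))) , s≤s (s≤s (s≤s ())) , _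

≢true⇒≡false : ∀ {b} → ¬ b ≡ true → b ≡ false
≢true⇒≡false {true}  b≢true = ⊥-elim (b≢true refl)
≢true⇒≡false {false} _      = refl

∀-Bool? : {P : Bool → Set} → (∀ b → Dec (P b)) → Dec (∀ b → P b)
∀-Bool? P? with P? true | P? false
... | yes pt | yes pf = yes λ { true → pt ; false → pf }
... | no ¬pt | _      = no λ p → ¬pt (p true)
... | yes _  | no ¬pf = no λ p → ¬pf (p false)

first-split : {P : A → Set} → Decidable P → ∀ {xs} → Any P xs →
              ∃ λ p → ∃ λ c → ∃ λ r → xs ≡ p ++ c ∷ r × All (λ x → ¬ P x) p × P c
first-split P? {x ∷ xs} (here px) = [] , x , xs , refl , [] , px
first-split P? {x ∷ xs} (there any) with P? x
... | yes px = [] , x , xs , refl , [] , px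
... | no ¬px with first-split P? any
...   | p , c , r , refl , none , pc = x ∷ p , c , r , refl , ¬px ∷ none , pc

infix-split : ∀ (u : List A) c₁ q c₂ v t →
              (u ++ c₁ ∷ q ++ c₂ ∷ v) ++ t ≡ u ++ (c₁ ∷ q ++ c₂ ∷ []) ++ (v ++ t)
infix-split u c₁ q c₂ v t = trans (++-assoc u (c₁ ∷ q ++ c₂ ∷ v) t)
  (cong (λ z → u ++ c₁ ∷ z) (trans (++-assoc q (c₂ ∷ v) t) (sym (++-assoc q (c₂ ∷ []) (v ++ t)))))

length-infix : ∀ (u : List A) c₁ q c₂ v → suc (suc (length q)) ≤ length (u ++ c₁ ∷ q ++ c₂ ∷ v)
length-infix []      c₁ []      c₂ v = s≤s (s≤s z≤n)
length-infix []      c₁ (x ∷ q) c₂ v = s≤s (length-infix [] x q c₂ v)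
length-infix (x ∷ u) c₁ q       c₂ v = ≤-trans (length-infix u c₁ q c₂ v) (n≤1+n _)

Any-infix : ∀ {P : A → Set} u c₁ q c₂ v → Any P (c₁ ∷ q ++ c₂ ∷ []) → Any P (u ++ c₁ ∷ q ++ c₂ ∷ v)
Any-infix u c₁ q c₂ v any = ++⁺ʳ u (extend any)
  where
  extend : ∀ {c q} → Any _ (c ∷ q ++ c₂ ∷ []) → Any _ (c ∷ q ++ c₂ ∷ v)
  extend {q = q}      (here pc)         = here pc
  extend {q = []}     (there (here p))  = there (here p)
  extend {q = x ∷ q}  (there any′)      = there (extend any′)

module Moves {n} (M : RawMap n) where

  flips : Fin n → Fin n → Bool
  flips f d = reachB (φ M) n f d ∨ reachB (φ M) n f (α M d)

  flipAt-flips : ∀ f o d → flips f d ≡ true → flipAt M f o d ≡ not (o d)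
  flipAt-flips f o d eq = cong (λ b → if b then not (o d) else o d) eq

  flipAt-fixes : ∀ f o d → flips f d ≡ false → flipAt M f o d ≡ o d
  flipAt-fixes f o d eq = cong (λ b → if b then not (o d) else o d) eq

  valid4-cong : ∀ {a b c d a′ b′ c′ d′} → a ≡ a′ → b ≡ b′ → c ≡ c′ → d ≡ d′ →
                valid4 M a b c d ≡ valid4 M a′ b′ c′ d′
  valid4-cong refl refl refl refl = refl

  valid4-at : (Fin n → Bool) → Fin n → Bool
  valid4-at T d = valid4 M (T d) (T (σ M d)) (T (σ M (σ M d))) (T (σ M (σ M (σ M d))))

  valid4-at-cong : ∀ {T T′} → T ≗ T′ → ∀ d → valid4-at T d ≡ valid4-at T′ d
  valid4-at-cong eq d = valid4-cong (eq _) (eq _) (eq _) (eq _)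

  flipAt≡xor : ∀ a o d → flipAt M a o d ≡ flips a d xor o d
  flipAt≡xor a o d with flips a d
  ... | true  = refl
  ... | false = refl

  -- sᵢ marks the darts reversed by the move; yᵢ is zᵢ overwritten by xᵢ on the marked darts.
  Transfer₄ : (s₀ s₁ s₂ s₃ x₀ x₁ x₂ x₃ z₀ z₁ z₂ z₃ : Bool) → Set
  Transfer₄ s₀ s₁ s₂ s₃ x₀ x₁ x₂ x₃ z₀ z₁ z₂ z₃ =
    valid4 M x₀ x₁ x₂ x₃ ≡ true → valid4 M y₀ y₁ y₂ y₃ ≡ true →
    valid4 M (s₀ xor x₀) (s₁ xor x₁) (s₂ xor x₂) (s₃ xor x₃) ≡ true →
    valid4 M (s₀ xor y₀) (s₁ xor y₁) (s₂ xor y₂) (s₃ xor y₃) ≡ true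
    where
    y₀ = if s₀ then x₀ else z₀
    y₁ = if s₁ then x₁ else z₁
    y₂ = if s₂ then x₂ else z₂
    y₃ = if s₃ then x₃ else z₃

  Transfer₄? : ∀ s₀ s₁ s₂ s₃ x₀ x₁ x₂ x₃ z₀ z₁ z₂ z₃ →
               Dec (Transfer₄ s₀ s₁ s₂ s₃ x₀ x₁ x₂ x₃ z₀ z₁ z₂ z₃)
  Transfer₄? _ _ _ _ _ _ _ _ _ _ _ _ =
    (_ ≟ᵇ true) →-dec (_ ≟ᵇ true) →-dec (_ ≟ᵇ true) →-dec (_ ≟ᵇ true)

  valid4-transfer : ∀ s₀ s₁ s₂ s₃ x₀ x₁ x₂ x₃ z₀ z₁ z₂ z₃ →
                    Transfer₄ s₀ s₁ s₂ s₃ x₀ x₁ x₂ x₃ z₀ z₁ z₂ z₃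
  valid4-transfer = from-yes
    (∀-Bool? λ s₀ → ∀-Bool? λ s₁ → ∀-Bool? λ s₂ → ∀-Bool? λ s₃ →
     ∀-Bool? λ x₀ → ∀-Bool? λ x₁ → ∀-Bool? λ x₂ → ∀-Bool? λ x₃ →
     ∀-Bool? λ z₀ → ∀-Bool? λ z₁ → ∀-Bool? λ z₂ → ∀-Bool? λ z₃ →
     Transfer₄? s₀ s₁ s₂ s₃ x₀ x₁ x₂ x₃ z₀ z₁ z₂ z₃)

  flipAt-cong : ∀ f {o o′} → o ≗ o′ → flipAt M f o ≗ flipAt M f o′
  flipAt-cong f eq d = cong (λ b → if flips f d then not b else b) (eq d)

  flipAt-comm : ∀ f g o → flipAt M f (flipAt M g o) ≗ flipAt M g (flipAt M f o)
  flipAt-comm f g o d with flips f d | flips g d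
  ... | true  | true  = refl
  ... | true  | false = refl
  ... | false | true  = refl
  ... | false | false = refl

  flipAt-involutive : ∀ f o → flipAt M f (flipAt M f o) ≗ o
  flipAt-involutive f o d with flips f d
  ... | true  = not-involutive (o d)
  ... | false = refl

  flipAt-same-flips : ∀ f g o → (∀ d → flips f d ≡ flips g d) → flipAt M f o ≗ flipAt M g o
  flipAt-same-flips f g o eq d = cong (λ b → if b then not (o d) else o d) (eq d)

  applySeq-++ : ∀ p q o → applySeq M (p ++ q) o ≡ applySeq M p (applySeq M q o)
  applySeq-++ []      q o = refl
  applySeq-++ (f ∷ p) q o = cong (flipAt M f) (applySeq-++ p q o)

  applySeq-cong : ∀ w {o o′} → o ≗ o′ → applySeq M w o ≗ applySeq M w o′
  applySeq-cong []      eq = eq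
  applySeq-cong (f ∷ w) eq = flipAt-cong f (applySeq-cong w eq)

  ValidOri-cong : ∀ {o o′} → o ≗ o′ → ValidOri M o → ValidOri M o′
  ValidOri-cong {o} {o′} eq (edges , vertices) =
    (λ d g → trans (sym (eq (α M d))) (trans (edges d g) (cong not (eq d)))) ,
    (λ d i → trans (sym (valid4-at-cong eq d)) (vertices d i))

  IsSeq-cong : ∀ w {o o′} → o ≗ o′ → IsSeq M w o → IsSeq M w o′
  IsSeq-cong []      eq _ = tt
  IsSeq-cong (f ∷ w) eq (hw , sq , valid) =
    IsSeq-cong w eq hw , sq , ValidOri-cong (flipAt-cong f (applySeq-cong w eq)) valid

  IsSeq-++⁻ : ∀ p q o → IsSeq M (p ++ q) o → IsSeq M q o × IsSeq M p (applySeq M q o)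
  IsSeq-++⁻ []      q o h = h , tt
  IsSeq-++⁻ (f ∷ p) q o (h , app) with IsSeq-++⁻ p q o h
  ... | hq , hp = hq , hp , subst (Applicable M f) (applySeq-++ p q o) app

  IsSeq-++⁺ : ∀ p q o → IsSeq M q o → IsSeq M p (applySeq M q o) → IsSeq M (p ++ q) o
  IsSeq-++⁺ []      q o hq hp = hq
  IsSeq-++⁺ (f ∷ p) q o hq (hp , app) =
    IsSeq-++⁺ p q o hq hp , subst (Applicable M f) (sym (applySeq-++ p q o)) app

  IsSeq⇒ValidOri : ∀ w o → ValidOri M o → IsSeq M w o → ValidOri M (applySeq M w o)
  IsSeq⇒ValidOri []      o valid _              = valid
  IsSeq⇒ValidOri (f ∷ w) o _     (_ , _ , valid) = valid

  IsSeq⇒All-IsSquare : ∀ w o → IsSeq M w o → All (IsSquare M) w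
  IsSeq⇒All-IsSquare []      o _            = []
  IsSeq⇒All-IsSquare (f ∷ w) o (h , sq , _) = sq ∷ IsSeq⇒All-IsSquare w o h

  Reduced-infix : ∀ x s y o → IsSeq M (x ++ s ++ y) o → Reduced M (x ++ s ++ y) o →
                  Reduced M s (applySeq M y o)
  Reduced-infix x s y o h red v hv v<s v≗s = red (x ++ v ++ y) hxvy (shorter v<s) same
    where
    hx = IsSeq-++⁻ x (s ++ y) o h
    hs = IsSeq-++⁻ s y o (proj₁ hx)
    sy≗vy : applySeq M (s ++ y) o ≗ applySeq M (v ++ y) o
    sy≗vy d = trans (cong (λ f → f d) (applySeq-++ s y o))
                (trans (sym (v≗s d)) (cong (λ f → f d) (sym (applySeq-++ v y o))))
    hxvy : IsSeq M (x ++ v ++ y) o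
    hxvy = IsSeq-++⁺ x (v ++ y) o (IsSeq-++⁺ v y o (proj₁ hs) hv) (IsSeq-cong x sy≗vy (proj₂ hx))
    same : ∀ d → applySeq M (x ++ v ++ y) o d ≡ applySeq M (x ++ s ++ y) o d
    same d = trans (cong (λ f → f d) (applySeq-++ x (v ++ y) o))
               (trans (sym (applySeq-cong x sy≗vy d)) (cong (λ f → f d) (sym (applySeq-++ x (s ++ y) o))))
    shorter : length v < length s → length (x ++ v ++ y) < length (x ++ s ++ y)
    shorter lt rewrite length-++ x {v ++ y} | length-++ x {s ++ y} | length-++ v {y} | length-++ s {y} =
      +-monoʳ-< (length x) (+-monoˡ-< (length y) lt)

  applySeq-untouched : ∀ w o d → All (λ g → flips g d ≡ false) w → applySeq M w o d ≡ o d
  applySeq-untouched []      o d []       = refl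
  applySeq-untouched (g ∷ w) o d (eq ∷ h) = trans (flipAt-fixes g (applySeq M w o) d eq) (applySeq-untouched w o d h)

  applySeq-touched-once : ∀ p c r o d → All (λ g → flips g d ≡ false) p → flips c d ≡ true →
                          All (λ g → flips g d ≡ false) r → applySeq M (p ++ c ∷ r) o d ≡ not (o d)
  applySeq-touched-once p c r o d hp hc hr = begin
    applySeq M (p ++ c ∷ r) o d              ≡⟨ cong (λ f → f d) (applySeq-++ p (c ∷ r) o) ⟩
    applySeq M p (applySeq M (c ∷ r) o) d    ≡⟨ applySeq-untouched p _ d hp ⟩
    flipAt M c (applySeq M r o) d            ≡⟨ flipAt-flips c (applySeq M r o) d hc ⟩
    not (applySeq M r o d)                   ≡⟨ cong not (applySeq-untouched r o d hr) ⟩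
    not (o d)                                ∎
    where open ≡-Reasoning

  applySeq-flipAt : ∀ w f o → applySeq M w (flipAt M f o) ≗ flipAt M f (applySeq M w o)
  applySeq-flipAt []      f o d = refl
  applySeq-flipAt (g ∷ w) f o d = trans (flipAt-cong g (applySeq-flipAt w f o) d) (flipAt-comm g f (applySeq M w o) d)

module Disk {n} (M : RawMap n) (disk : IsDisk M) where
  open IsDisk disk
  open Moves M

  σ′ α′ φ′ : Fin n → Fin n
  σ′ = σ M
  α′ = α M
  φ′ = φ M

  σ′-injective : ∀ {x y} → σ′ x ≡ σ′ y → x ≡ y
  σ′-injective {x} {y} eq = trans (sym (σ-inv₁ x)) (trans (cong (σ⁻ M) eq) (σ-inv₁ y))

  α′-injective : ∀ {x y} → α′ x ≡ α′ y → x ≡ y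
  α′-injective {x} {y} eq = trans (sym (α-invol x)) (trans (cong α′ eq) (α-invol y))

  φ′-injective : ∀ {x y} → φ′ x ≡ φ′ y → x ≡ y
  φ′-injective {x} {y} eq =
    α′-injective (trans (sym (σ-inv₂ (α′ x))) (trans (cong σ′ eq) (σ-inv₂ (α′ y))))

  IsSquare⇒3≤n : ∀ {f} → IsSquare M f → 3 ≤ n
  IsSquare⇒3≤n {f} (_ , φ²f≢f , _) = distinct³⇒3≤n f≢φf (f≢φf ∘ φ′-injective) (φ²f≢f ∘ sym)
    where
    f≢φf : f ≢ φ′ f
    f≢φf eq = φ²f≢f (trans (cong φ′ (sym eq)) (sym eq))

  α≡σ∘φ : ∀ x → α′ x ≡ σ′ (φ′ x)
  α≡σ∘φ x = sym (σ-inv₂ (α′ x))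

  flips-α : ∀ a d → flips a (α′ d) ≡ flips a d
  flips-α a d = trans (cong (λ t → reachB (φ M) n a (α M d) ∨ reachB (φ M) n a t) (α-invol d))
                      (∨-comm (reachB (φ M) n a (α M d)) (reachB (φ M) n a d))

  flipAt-valid-transfer : ∀ {a} T Z → ValidOri M T → ValidOri M Z → (∀ d → flips a d ≡ true → Z d ≡ T d) →
                          ValidOri M (flipAt M a T) → ValidOri M (flipAt M a Z)
  flipAt-valid-transfer {a} T Z vT vZ agree vF = edges , at-vertices
    where
    Y : Fin n → Bool
    Y y = if flips a y then T y else Z y
    Z≗Y : Z ≗ Y
    Z≗Y y with flips a y | agree y
    ... | true  | eq = eq refl
    ... | false | _  = refl
    flipZ≗xorY : flipAt M a Z ≗ λ y → flips a y xor Y y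
    flipZ≗xorY y = trans (flipAt≡xor a Z y) (cong (flips a y xor_) (Z≗Y y))
    edges : ∀ d → Graph M d → flipAt M a Z (α′ d) ≡ not (flipAt M a Z d)
    edges d g = begin
      flipAt M a Z (α′ d)         ≡⟨ flipAt≡xor a Z (α′ d) ⟩
      flips a (α′ d) xor Z (α′ d) ≡⟨ cong₂ _xor_ (flips-α a d) (proj₁ vZ d g) ⟩
      flips a d xor not (Z d)     ≡⟨ xor-not (flips a d) (Z d) ⟩
      not (flips a d xor Z d)     ≡⟨ cong not (flipAt≡xor a Z d) ⟨
      not (flipAt M a Z d)        ∎
      where
      open ≡-Reasoning
      xor-not : ∀ s x → s xor not x ≡ not (s xor x)
      xor-not true  x = refl
      xor-not false x = refl
    at-vertices : ∀ d → InternalAt M d → valid4-at (flipAt M a Z) d ≡ true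
    at-vertices d i = trans (valid4-at-cong flipZ≗xorY d)
      (valid4-transfer (s d) (s (σ′ d)) (s (σ′ (σ′ d))) (s (σ′ (σ′ (σ′ d))))
                       (T d) (T (σ′ d)) (T (σ′ (σ′ d))) (T (σ′ (σ′ (σ′ d))))
                       (Z d) (Z (σ′ d)) (Z (σ′ (σ′ d))) (Z (σ′ (σ′ (σ′ d))))
        (proj₂ vT d i)
        (trans (sym (valid4-at-cong Z≗Y d)) (proj₂ vZ d i))
        (trans (sym (valid4-at-cong (flipAt≡xor a T) d)) (proj₂ vF d i)))
      where s = flips a

module Faces {n} (M : RawMap n) (disk : IsDisk M) (simple : Simple M) (3≤n : 3 ≤ n) where
  open IsDisk disk
  open Disk M disk public
  open Moves M
  open FourPeriodic φ′ φ′-injective 3≤n public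

  InFace : Fin n → Fin n → Set
  InFace = Orbit φ′

  InFace-sym : ∀ {y z} → HasPeriod4 z → InFace y z → InFace z y
  InFace-sym p o = Orbit-sym (HasPeriod4-Orbit⁻ p o) o

  Square : Fin n → Set
  Square d = HasPeriod4 d × (∀ x → InFace d x → Graph M x)

  IsSquare⇒Square : ∀ {d} → IsSquare M d → Square d
  IsSquare⇒Square {d} (p , _ , g₀ , g₁ , g₂ , g₃) = p , graph
    where
    graph : ∀ x → InFace d x → Graph M x
    graph x o with orbit-cases p o
    ... | inj₁ refl                  = g₀
    ... | inj₂ (inj₁ refl)           = g₁
    ... | inj₂ (inj₂ (inj₁ refl))    = g₂
    ... | inj₂ (inj₂ (inj₂ refl))    = g₃

  Square-InFace : ∀ {d x} → Square d → InFace d x → Square x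
  Square-InFace (p , graph) o = HasPeriod4-Orbit p o , λ y o′ → graph y (Orbit-trans φ′ o o′)

  Square-φ : ∀ {d} → Square d → Square (φ′ d)
  Square-φ q = Square-InFace q (Orbit-step φ′ _)

  Square⇒Graph : ∀ {d} → Square d → Graph M d
  Square⇒Graph (_ , graph) = graph _ (Orbit-refl φ′ _)

  Square⇒InternalAt : ∀ {d} → Square d → InternalAt M d
  Square⇒InternalAt {d} (p , graph) = subst (InternalAt M) p (internal (graph _ (3 , refl)) (graph _ (4 , refl)))
    where
    internal : ∀ {x} → Graph M x → Graph M (φ′ x) → InternalAt M (φ′ x)
    internal {x} gx gφx with vertices (φ′ x) gφx
    ... | inj₁ i = i
    ... | inj₂ (_ , arc-σ , _) with () ← trans (sym arc-σ) (trans (cong (arc M) (σ-inv₂ (α′ x))) (trans (arc-α x) gx))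

  σ-SameVertex : ∀ x j → j ≤ 3 → SameVertex M x (iter σ′ j x)
  σ-SameVertex x j j≤3 = iter⇒reachB σ′ n j x (≤-trans j≤3 3≤n)

  σ⁴≡id : ∀ {x} → InternalAt M x → σ′ (σ′ (σ′ (σ′ x))) ≡ x
  σ⁴≡id = proj₁

  σ²≢id : ∀ {x} → InternalAt M x → σ′ (σ′ x) ≢ x
  σ²≢id = proj₁ ∘ proj₂

  σ≢id : ∀ {x} → InternalAt M x → σ′ x ≢ x
  σ≢id i eq = σ²≢id i (trans (cong σ′ eq) eq)

  Graph-σ³ : ∀ {x} → InternalAt M x → Graph M (σ′ (σ′ (σ′ x)))
  Graph-σ³ i = proj₂ (proj₂ (proj₂ (proj₂ (proj₂ i))))

  no-loop : ∀ d → Graph M d → ¬ SameVertex M d (α′ d)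
  no-loop = proj₁ simple

  no-multi-edge : ∀ d e → Graph M d → Graph M e → SameVertex M d e → d ≢ e → ¬ SameVertex M (α′ d) (α′ e)
  no-multi-edge = proj₂ simple

  Square⇒¬InFace-α : ∀ {d} → Square d → ¬ InFace d (α′ d)
  Square⇒¬InFace-α {d} q o with orbit-cases (proj₁ q) o
  ... | inj₁ eq = α-fpf d eq
  ... | inj₂ (inj₁ eq) = σ≢id (Square⇒InternalAt (Square-φ q)) (trans (sym (α≡σ∘φ d)) eq)
  ... | inj₂ (inj₂ (inj₁ eq)) =
    no-loop (φ′ d) (Square⇒Graph (Square-φ q))
      (subst (SameVertex M (φ′ d)) (trans (cong σ′ (trans (sym (α≡σ∘φ d)) eq)) (sym (α≡σ∘φ (φ′ d))))
        (σ-SameVertex (φ′ d) 2 (s≤s (s≤s z≤n))))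
  ... | inj₂ (inj₂ (inj₂ eq)) = σ≢id (Square⇒InternalAt q)
    (trans (cong σ′ (sym (proj₁ q))) (trans (sym (α≡σ∘φ (φ′ (φ′ (φ′ d))))) (trans (cong α′ (sym eq)) (α-invol d))))

  module Corner {d : Fin n} (q : Square d) where
    private
      c = φ′ d
      ic = Square⇒InternalAt (Square-φ q)
      iφc = Square⇒InternalAt (Square-φ (Square-φ q))
      gd = Square⇒Graph q
      gc = Square⇒Graph (Square-φ q)

    σ²∉face : ¬ InFace d (σ′ (σ′ c))
    σ²∉face o with orbit-cases (proj₁ q) o
    ... | inj₁ eq = no-loop d gd (subst (SameVertex M d)
            (trans (cong (λ t → σ′ (σ′ (σ′ t))) (sym eq)) (trans (cong σ′ (σ⁴≡id ic)) (sym (α≡σ∘φ d))))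
            (σ-SameVertex d 3 ≤-refl))
    ... | inj₂ (inj₁ eq) = σ²≢id ic eq
    ... | inj₂ (inj₂ (inj₁ eq)) = no-loop c gc (subst (SameVertex M c)
            (trans (cong σ′ eq) (sym (α≡σ∘φ c))) (σ-SameVertex c 3 ≤-refl))
    ... | inj₂ (inj₂ (inj₂ eq)) = no-multi-edge c (σ′ (σ′ (σ′ c))) gc (Graph-σ³ ic) (σ-SameVertex c 3 ≤-refl)
            (λ eq′ → σ≢id ic (trans (cong σ′ eq′) (σ⁴≡id ic)))
            (subst₂ (SameVertex M) (sym (α≡σ∘φ c)) (sym α-σ³c≡φc)
               (subst (SameVertex M (σ′ (φ′ c))) (σ⁴≡id iφc) (σ-SameVertex (σ′ (φ′ c)) 3 ≤-refl)))
      where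
      α-σ³c≡φc : α′ (σ′ (σ′ (σ′ c))) ≡ φ′ c
      α-σ³c≡φc = trans (cong α′ (trans (cong σ′ eq) (sym (α≡σ∘φ (φ′ c))))) (α-invol (φ′ c))

    σ³∉face : ¬ InFace d (σ′ (σ′ (σ′ c)))
    σ³∉face o with orbit-cases (proj₁ q) o
    ... | inj₁ eq = no-loop d gd (subst (SameVertex M d)
            (trans (cong (λ t → σ′ (σ′ t)) (sym eq)) (trans (cong σ′ (σ⁴≡id ic)) (sym (α≡σ∘φ d))))
            (σ-SameVertex d 2 (s≤s (s≤s z≤n))))
    ... | inj₂ (inj₁ eq) = σ≢id ic (trans (cong σ′ (sym eq)) (σ⁴≡id ic))
    ... | inj₂ (inj₂ (inj₁ eq)) = α-fpf c (trans (α≡σ∘φ c) (trans (cong σ′ (sym eq)) (σ⁴≡id ic)))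
    ... | inj₂ (inj₂ (inj₂ eq)) = σ≢id iφc (sym (trans φc≡αc (α≡σ∘φ c)))
      where
      φc≡αc : φ′ c ≡ α′ c
      φc≡αc = trans (sym (α-invol (φ′ c))) (cong α′ (trans (α≡σ∘φ (φ′ c)) (trans (cong σ′ (sym eq)) (σ⁴≡id ic))))

    α-σ²∉face : ¬ InFace d (α′ (σ′ (σ′ c)))
    α-σ²∉face o = Square⇒¬InFace-α q (subst (InFace d) (sym αd≡φx) (Orbit-trans φ′ o (Orbit-step φ′ _)))
      where
      αd≡φx : α′ d ≡ φ′ (α′ (σ′ (σ′ c)))
      αd≡φx = trans (α≡σ∘φ d) (σ′-injective (trans (sym (α-invol (σ′ (σ′ c)))) (α≡σ∘φ _)))

    α-σ³∉face : ¬ InFace d (α′ (σ′ (σ′ (σ′ c))))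
    α-σ³∉face o = σ²∉face (subst (InFace d) (sym σ²c≡φx) (Orbit-trans φ′ o (Orbit-step φ′ _)))
      where
      σ²c≡φx : σ′ (σ′ c) ≡ φ′ (α′ (σ′ (σ′ (σ′ c))))
      σ²c≡φx = σ′-injective (trans (sym (α-invol (σ′ (σ′ (σ′ c))))) (α≡σ∘φ _))

  flips⇒InFace : ∀ {a y} → flips a y ≡ true → InFace a y ⊎ InFace a (α′ y)
  flips⇒InFace {a} {y} eq with ∨-≡-true⁻ (reachB φ′ n a y) _ eq
  ... | inj₁ r = inj₁ (reachB⇒Orbit r)
  ... | inj₂ r = inj₂ (reachB⇒Orbit r)

  InFace⇒flips : ∀ {a y} → HasPeriod4 a → InFace a y → flips a y ≡ true
  InFace⇒flips {a} {y} p o = cong (_∨ reachB φ′ n a (α′ y)) (Orbit⇒reachB p o)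

  InFace-α⇒flips : ∀ {a y} → HasPeriod4 a → InFace a (α′ y) → flips a y ≡ true
  InFace-α⇒flips {a} {y} p o = ∨-≡-trueʳ (reachB φ′ n a y) (Orbit⇒reachB p o)

  valid4-flip₀₁⇒≡ : ∀ x₀ x₁ x₂ x₃ → valid4 M x₀ x₁ x₂ x₃ ≡ true →
                    valid4 M (not x₀) (not x₁) x₂ x₃ ≡ true → x₀ ≡ x₁
  valid4-flip₀₁⇒≡ true  true  _     _     _  _  = refl
  valid4-flip₀₁⇒≡ false false _     _     _  _  = refl
  valid4-flip₀₁⇒≡ true  false true  true  () _
  valid4-flip₀₁⇒≡ true  false true  false () _
  valid4-flip₀₁⇒≡ true  false false true  _  ()
  valid4-flip₀₁⇒≡ true  false false false () _
  valid4-flip₀₁⇒≡ false true  true  true  () _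
  valid4-flip₀₁⇒≡ false true  true  false _  ()
  valid4-flip₀₁⇒≡ false true  false true  () _
  valid4-flip₀₁⇒≡ false true  false false () _

  -- Flipping the face reverses exactly the two darts of the corner vertex φ′ d that lie on
  -- face edges (σ²- and σ³-darts are off the face by simplicity); the only valid patterns
  -- that stay valid under this agree on those two darts.
  corner-agrees : ∀ {a d} T → HasPeriod4 a → Square d → InFace a d → ValidOri M T →
                  ValidOri M (flipAt M a T) → T (φ′ d) ≡ T (σ′ (φ′ d))
  corner-agrees {a} {d} T pa q a∋d vT vF =
    valid4-flip₀₁⇒≡ _ _ _ _ (proj₂ vT c ic) (trans (sym flipped) (proj₂ vF c ic))
    where
    open Corner q
    c = φ′ d
    ic = Square⇒InternalAt (Square-φ q)
    d∋a = InFace-sym (HasPeriod4-Orbit pa a∋d) a∋d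
    α-σc≡d : α′ (σ′ c) ≡ d
    α-σc≡d = trans (cong α′ (sym (α≡σ∘φ d))) (α-invol d)
    unflipped : ∀ y → ¬ InFace d y → ¬ InFace d (α′ y) → flips a y ≡ false
    unflipped y y∉ αy∉ = ≢true⇒≡false λ eq →
      [ (λ o → y∉ (Orbit-trans φ′ d∋a o)) , (λ o → αy∉ (Orbit-trans φ′ d∋a o)) ]′ (flips⇒InFace eq)
    flipped : valid4-at (flipAt M a T) c
              ≡ valid4 M (not (T c)) (not (T (σ′ c))) (T (σ′ (σ′ c))) (T (σ′ (σ′ (σ′ c))))
    flipped = valid4-cong
      (flipAt-flips a T c (InFace⇒flips pa (Orbit-trans φ′ a∋d (Orbit-step φ′ d))))
      (flipAt-flips a T (σ′ c) (InFace-α⇒flips pa (subst (InFace a) (sym α-σc≡d) a∋d)))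
      (flipAt-fixes a T (σ′ (σ′ c)) (unflipped _ σ²∉face α-σ²∉face))
      (flipAt-fixes a T (σ′ (σ′ (σ′ c))) (unflipped _ σ³∉face α-σ³∉face))

  alternates : ∀ {a x} T → Square a → InFace a x → ValidOri M T → ValidOri M (flipAt M a T) →
               T (φ′ x) ≡ not (T x)
  alternates {a} {x} T qa a∋x vT vF = begin
    T (φ′ x)        ≡⟨ corner-agrees T (proj₁ qa) (Square-InFace qa a∋x) a∋x vT vF ⟩
    T (σ′ (φ′ x))   ≡⟨ cong T (α≡σ∘φ x) ⟨
    T (α′ x)        ≡⟨ proj₁ vT x (Square⇒Graph (Square-InFace qa a∋x)) ⟩
    not (T x)       ∎
    where open ≡-Reasoning

module Neighbours {n} (M : RawMap n) (disk : IsDisk M) (simple : Simple M) (3≤n : 3 ≤ n) where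
  open Faces M disk simple 3≤n
  open Moves M

  Word : Fin n → List (Fin n) → Fin n → List (Fin n)
  Word a mid b = a ∷ mid ++ b ∷ []

  SameFace? : ∀ x → Decidable (SameFace M x)
  SameFace? x y = reachB φ′ n x y ≟ᵇ true

  SameFace⇒flips≡ : ∀ {a b} → HasPeriod4 a → HasPeriod4 b → SameFace M a b → ∀ d → flips a d ≡ flips b d
  SameFace⇒flips≡ pa pb a~b d = cong₂ _∨_ (same d) (same (α′ d))
    where
    a↝b = reachB⇒Orbit a~b
    same : ∀ y → reachB φ′ n _ y ≡ reachB φ′ n _ y
    same y = ⇔→≡ (mk⇔ (λ r → Orbit⇒reachB pb (Orbit-trans φ′ (Orbit-sym pa a↝b) (reachB⇒Orbit r)))
                      (λ r → Orbit⇒reachB pa (Orbit-trans φ′ a↝b (reachB⇒Orbit r))))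

  flips-≡-false : ∀ {a x g} → HasPeriod4 a → InFace a x → IsSquare M g →
                  ¬ SameFace M a g → ¬ SameFace M (α′ x) g → flips g x ≡ false
  flips-≡-false {a} {x} {g} pa a∋x sq a≁g αx≁g = ≢true⇒≡false λ eq → case (flips⇒InFace eq)
    where
    pg = proj₁ sq
    case : InFace g x ⊎ InFace g (α′ x) → ⊥
    case (inj₁ g∋x)  = a≁g (Orbit⇒reachB pa (Orbit-trans φ′ a∋x (Orbit-sym pg g∋x)))
    case (inj₂ g∋αx) = αx≁g (Orbit⇒reachB (HasPeriod4-Orbit pg g∋αx) (Orbit-sym pg g∋αx))

  All-flips-≡-false : ∀ {a x l} → HasPeriod4 a → InFace a x → All (IsSquare M) l →
                      All (λ g → ¬ SameFace M a g) l → All (λ g → ¬ SameFace M (α′ x) g) l →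
                      All (λ g → flips g x ≡ false) l
  All-flips-≡-false pa a∋x squares a≁ αx≁ =
    All.zipWith (λ (sq , a≁g , αx≁g) → flips-≡-false pa a∋x sq a≁g αx≁g) (squares , All.zip (a≁ , αx≁))

  EdgeDisjoint : Fin n → Fin n → Set
  EdgeDisjoint a g = ∀ y → flips a y ≡ true → flips g y ≡ false

  EdgeDisjoint-intro : ∀ {a g} → HasPeriod4 a → IsSquare M g → ¬ SameFace M a g →
                       (∀ x → InFace a x → ¬ SameFace M (α′ x) g) → EdgeDisjoint a g
  EdgeDisjoint-intro {a} {g} pa sq a≁g adjacent y eq with flips⇒InFace eq
  ... | inj₁ a∋y  = flips-≡-false pa a∋y sq a≁g (adjacent y a∋y)
  ... | inj₂ a∋αy = trans (sym (flips-α g y)) (flips-≡-false pa a∋αy sq a≁g (adjacent (α′ y) a∋αy))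

  IsSeq-flipAt : ∀ {a} l X → ValidOri M X → ValidOri M (flipAt M a X) → All (EdgeDisjoint a) l →
                 IsSeq M l X → IsSeq M l (flipAt M a X)
  IsSeq-flipAt         []      X vX vaX []             _               = tt
  IsSeq-flipAt {a} (f ∷ l) X vX vaX (disj ∷ disjs) (hl , sq , vZ) =
    IsSeq-flipAt l X vX vaX disjs hl , sq ,
    ValidOri-cong commute (flipAt-valid-transfer X Z vX vZ agree vaX)
    where
    S = applySeq M l X
    Z = flipAt M f S
    agree : ∀ y → flips a y ≡ true → Z y ≡ X y
    agree y eq = trans (flipAt-fixes f S y (disj y eq)) (applySeq-untouched l X y (All.map (λ d → d y eq) disjs))
    commute : flipAt M a Z ≗ flipAt M f (applySeq M l (flipAt M a X))
    commute d = trans (flipAt-comm a f S d) (sym (flipAt-cong f (applySeq-flipAt l a X) d))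

  module Bracketed {o a mid b} (valid : ValidOri M o) (h : IsSeq M (Word a mid b) o) (a~b : SameFace M a b) where
    private
      split = IsSeq-++⁻ mid (b ∷ []) o (proj₁ h)
      pb = proj₁ (proj₁ (proj₂ (proj₁ split)))

    qa : Square a
    qa = IsSquare⇒Square (proj₁ (proj₂ h))

    pa : HasPeriod4 a
    pa = proj₁ qa

    X Y : Fin n → Bool
    X = flipAt M b o
    Y = applySeq M mid X

    hmid : IsSeq M mid X
    hmid = proj₂ split

    vX : ValidOri M X
    vX = proj₂ (proj₂ (proj₁ split))

    vY : ValidOri M Y
    vY = IsSeq⇒ValidOri mid X vX hmid

    vaY : ValidOri M (flipAt M a Y)
    vaY = subst (λ T → ValidOri M (flipAt M a T)) (applySeq-++ mid (b ∷ []) o) (proj₂ (proj₂ h))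

    flipAt-a-X≗o : flipAt M a X ≗ o
    flipAt-a-X≗o d = trans (flipAt-same-flips a b X (SameFace⇒flips≡ pa pb a~b) d) (flipAt-involutive b o d)

    vaX : ValidOri M (flipAt M a X)
    vaX = ValidOri-cong (λ d → sym (flipAt-a-X≗o d)) valid

    EdgeDisjoint⇒¬Reduced : All (EdgeDisjoint a) mid → ¬ Reduced M (Word a mid b) o
    EdgeDisjoint⇒¬Reduced disjoint red = red mid hmid′ (s≤s (length-++-≤ˡ mid)) same
      where
      hmid′ : IsSeq M mid o
      hmid′ = IsSeq-cong mid flipAt-a-X≗o (IsSeq-flipAt mid X vX vaX disjoint hmid)
      same : ∀ d → applySeq M mid o d ≡ applySeq M (Word a mid b) o d
      same d = begin
        applySeq M mid o d                  ≡⟨ applySeq-cong mid flipAt-a-X≗o d ⟨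
        applySeq M mid (flipAt M a X) d     ≡⟨ applySeq-flipAt mid a X d ⟩
        flipAt M a Y d                      ≡⟨ cong (λ T → flipAt M a T d) (applySeq-++ mid (b ∷ []) o) ⟨
        applySeq M (Word a mid b) o d       ∎
        where open ≡-Reasoning

    -- Around the face of a both X and Y alternate (a is applicable to both), so agreeing
    -- on one edge they agree on all four.
    face-edges-preserved : ∀ {e} → InFace a e → All (λ g → flips g e ≡ false) mid → ∀ x → InFace a x → X x ≡ Y x
    face-edges-preserved {e} a∋e free x a∋x with Orbit-trans φ′ (Orbit-sym pa a∋e) a∋x
    ... | j , refl = along j
      where
      along : ∀ j → X (iter φ′ j e) ≡ Y (iter φ′ j e)
      along zero    = sym (applySeq-untouched mid X e free)
      along (suc j) = begin
        X (φ′ y)  ≡⟨ alternates X qa a∋y vX vaX ⟩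
        not (X y) ≡⟨ cong not (along j) ⟩
        not (Y y) ≡⟨ alternates Y qa a∋y vY vaY ⟨
        Y (φ′ y)  ∎
        where
        open ≡-Reasoning
        y = iter φ′ j e
        a∋y = Orbit-trans φ′ a∋e (j , refl)

  NeighboursVisited : ℕ → Set
  NeighboursVisited k = ∀ o a mid b → length mid < k → ValidOri M o →
    IsSeq M (Word a mid b) o → Reduced M (Word a mid b) o → SameFace M a b →
    ∀ e → SameFace M a e → Any (SameFace M (α′ e)) (Word a mid b)

  NeighboursVisited-infix : ∀ {k} → NeighboursVisited k → ∀ {o a mid b} u c₁ q c₂ v →
    a ∷ mid ≡ u ++ c₁ ∷ q ++ c₂ ∷ v → length mid ≤ k → ValidOri M o →
    IsSeq M (Word a mid b) o → Reduced M (Word a mid b) o →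
    SameFace M c₁ c₂ → ∀ e → SameFace M c₁ e → Any (SameFace M (α′ e)) (Word c₁ q c₂)
  NeighboursVisited-infix {k} ih {o} {a} {mid} {b} u c₁ q c₂ v eq mid≤k valid h red =
    ih (applySeq M y o) c₁ q c₂ q<k (IsSeq⇒ValidOri y o valid (proj₁ hy)) (proj₂ hy)
       (Reduced-infix u (Word c₁ q c₂) y o h′ red′)
    where
    y = v ++ b ∷ []
    split : Word a mid b ≡ u ++ Word c₁ q c₂ ++ y
    split = trans (cong (_++ b ∷ []) eq) (infix-split u c₁ q c₂ v (b ∷ []))
    h′ = subst (λ w → IsSeq M w o) split h
    red′ = subst (λ w → Reduced M w o) split red
    hy = IsSeq-++⁻ (Word c₁ q c₂) y o (proj₁ (IsSeq-++⁻ u _ o h′))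
    q<k : length q < k
    q<k = ≤-trans (≤-pred (subst (suc (suc (length q)) ≤_) (cong length (sym eq)) (length-infix u c₁ q c₂ v))) mid≤k

  ¬visited-once : ∀ {o a b} p c r → ValidOri M o → IsSeq M (Word a (p ++ c ∷ r) b) o → SameFace M a b →
    All (λ g → ¬ SameFace M a g) (p ++ c ∷ r) →
    ∀ {e} → InFace a e → All (λ g → ¬ SameFace M (α′ e) g) (p ++ c ∷ r) →
    ∀ {x} → InFace a x → All (λ g → ¬ SameFace M (α′ x) g) p → SameFace M (α′ x) c →
    All (λ g → ¬ SameFace M (α′ x) g) r → ⊥
  ¬visited-once p c r valid h a~b a≁ a∋e αe≁ {x} a∋x before αx~c after =
    not-¬ refl (trans (face-edges-preserved a∋e (All-flips-≡-false pa a∋e squares a≁ αe≁) x a∋x) Yx≡¬Xx)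
    where
    open Bracketed valid h a~b
    squares = IsSeq⇒All-IsSquare _ X hmid
    pc = proj₁ (All.head (++⁻ʳ p squares))
    Yx≡¬Xx : Y x ≡ not (X x)
    Yx≡¬Xx = applySeq-touched-once p c r X x
      (All-flips-≡-false pa a∋x (++⁻ˡ p squares) (++⁻ˡ p a≁) before)
      (InFace-α⇒flips pc (InFace-sym pc (reachB⇒Orbit αx~c)))
      (All-flips-≡-false pa a∋x (All.tail (++⁻ʳ p squares)) (All.tail (++⁻ʳ p a≁)) after)

  visited-twice⇒returns : ∀ {k} → NeighboursVisited k → ∀ {o a b} p c q c₂ v → let mid = p ++ c ∷ q ++ c₂ ∷ v in
    length mid ≤ k → ValidOri M o → IsSeq M (Word a mid b) o → Reduced M (Word a mid b) o →
    ∀ {x} → InFace a x → SameFace M (α′ x) c → SameFace M (α′ x) c₂ → Any (SameFace M a) mid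
  visited-twice⇒returns ih {o} {a} {b} p c q c₂ v mid≤k valid h red {x} a∋x αx~c αx~c₂ =
    Any-infix p c q c₂ v (Any.map toFace-a found)
    where
    pa = proj₁ (proj₁ (proj₂ h))
    mid-squares = IsSeq⇒All-IsSquare (p ++ c ∷ q ++ c₂ ∷ v) _ (proj₂ (IsSeq-++⁻ _ (b ∷ []) o (proj₁ h)))
    pc = proj₁ (All.head (++⁻ʳ p mid-squares))
    c∋αx = InFace-sym pc (reachB⇒Orbit αx~c)
    found = NeighboursVisited-infix ih (a ∷ p) c q c₂ v refl mid≤k valid h red
              (Orbit⇒reachB pc (Orbit-trans φ′ c∋αx (reachB⇒Orbit αx~c₂))) (α′ x) (Orbit⇒reachB pc c∋αx)
    toFace-a : ∀ {g} → SameFace M (α′ (α′ x)) g → SameFace M a g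
    toFace-a r = Orbit⇒reachB pa (Orbit-trans φ′ a∋x (subst (λ z → InFace z _) (IsDisk.α-invol disk x) (reachB⇒Orbit r)))

  neighbours-unvisited : ∀ {k} → NeighboursVisited k → ∀ {o a mid b} → length mid ≤ k → ValidOri M o →
    IsSeq M (Word a mid b) o → Reduced M (Word a mid b) o → SameFace M a b →
    All (λ g → ¬ SameFace M a g) mid → ∀ {e} → InFace a e → All (λ g → ¬ SameFace M (α′ e) g) mid →
    ∀ x → InFace a x → All (λ g → ¬ SameFace M (α′ x) g) mid
  neighbours-unvisited ih {mid = mid} mid≤k valid h red a~b a≁ a∋e αe≁ x a∋x with any? (SameFace? (α′ x)) mid
  ... | no none = ¬Any⇒All¬ mid none
  ... | yes some with first-split (SameFace? (α′ x)) some
  ...   | p , c , r , refl , before , αx~c with any? (SameFace? (α′ x)) r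
  ...     | no after = ⊥-elim (¬visited-once p c r valid h a~b a≁ a∋e αe≁ a∋x before αx~c (¬Any⇒All¬ r after))
  ...     | yes again with first-split (SameFace? (α′ x)) again
  ...       | q , c₂ , v , refl , _ , αx~c₂ =
    ⊥-elim (All¬⇒¬Any a≁ (visited-twice⇒returns ih p c q c₂ v mid≤k valid h red a∋x αx~c αx~c₂))

  ¬never-returns : ∀ {k} → NeighboursVisited k → ∀ {o a mid b} → length mid ≤ k → ValidOri M o →
    IsSeq M (Word a mid b) o → Reduced M (Word a mid b) o → SameFace M a b → ∀ {e} → SameFace M a e →
    All (λ g → ¬ SameFace M a g) mid → All (λ g → ¬ SameFace M (α′ e) g) mid → ⊥
  ¬never-returns ih {mid = mid} mid≤k valid h red a~b a~e a≁ αe≁ = EdgeDisjoint⇒¬Reduced disjoint red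
    where
    open Bracketed valid h a~b
    squares = IsSeq⇒All-IsSquare mid X hmid
    adjacent = neighbours-unvisited ih mid≤k valid h red a~b a≁ (reachB⇒Orbit a~e) αe≁
    disjoint : All (EdgeDisjoint _) mid
    disjoint = All.tabulate λ g∈ →
      EdgeDisjoint-intro pa (All.lookup squares g∈) (All.lookup a≁ g∈) (λ x a∋x → All.lookup (adjacent x a∋x) g∈)

  neighbours-visited : ∀ k → NeighboursVisited k
  neighbours-visited (suc k) o a mid b (s≤s mid≤k) valid h red a~b e a~e with any? (SameFace? (α′ e)) (Word a mid b)
  ... | yes found = found
  ... | no none with any? (SameFace? a) mid
  ...   | no never = ⊥-elim (¬never-returns (neighbours-visited k) mid≤k valid h red a~b a~e (¬Any⇒All¬ mid never)
                               (++⁻ˡ mid (All.tail (¬Any⇒All¬ (Word a mid b) none))))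
  ...   | yes returns with first-split (SameFace? a) returns
  ...     | p , c , r , refl , _ , a~c =
    ++⁺ˡ (Any-infix [] a p c r (NeighboursVisited-infix (neighbours-visited k) [] a p c r refl mid≤k valid h red a~c e a~e))

lemma7p18 : ∀ {n} (D : Config n) → ValidOri (raw D) (ori D) → WellOriented D →
    (a : Fin n) (mid : List (Fin n)) (b : Fin n) →
    IsSeq (raw D) (a ∷ mid ++ b ∷ []) (ori D) →
    Reduced (raw D) (a ∷ mid ++ b ∷ []) (ori D) →
    (f₀ : Fin n) → Applicable (raw D) f₀ (ori D) →
    SameFace (raw D) a f₀ → SameFace (raw D) b f₀ →
    ∀ e → SameFace (raw D) f₀ e →
    Any (λ g → SameFace (raw D) (α (raw D) e) g) (a ∷ mid ++ b ∷ [])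
lemma7p18 D valid (simple , _) a mid b h red f₀ (f₀-square , _) a~f₀ b~f₀ e f₀~e =
  neighbours-visited (suc (length mid)) (ori D) a mid b ≤-refl valid h red a~b e a~e
  where
  3≤n = Disk.IsSquare⇒3≤n (raw D) (disk D) f₀-square
  open Faces (raw D) (disk D) simple 3≤n
  open Neighbours (raw D) (disk D) simple 3≤n using (neighbours-visited)
  pa  = proj₁ (proj₁ (proj₂ h))
  pf₀ = proj₁ f₀-square
  a~b = Orbit⇒reachB pa (Orbit-trans φ′ (reachB⇒Orbit a~f₀) (InFace-sym pf₀ (reachB⇒Orbit b~f₀)))
  a~e = Orbit⇒reachB pa (Orbit-trans φ′ (reachB⇒Orbit a~f₀) (reachB⇒Orbit f₀~e))
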